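{- Let $K$ be an infinite class of finite graphs which is closed under isomorphism, has the hereditary property, contains at least one graph with an edge, and has the free amalgamation property. Let $M$ be the Fra\"{i}ss\'{e} limit of $K$. Then $\chi(M)=\omega$.
   Context: A graph is a structure $(G,R)$ where $R\subseteq G^2$ is symmetric and irreflexive (the edge relation); subgraphs are induced subgraphs. The chromatic number $\chi(G)$ is the least cardinal $\kappa$ such that there is $f\colon G\to\kappa$ with $f(u)\neq f(v)$ whenever $R(u,v)$. A class $K$ of finite graphs has the hereditary property if it is closed under induced subgraphs. For graphs $A\subseteq B$, $A\subseteq C$ (induced), a graph $D$ is the free amalgam $B\oplus_A C$ of $B$ and $C$ over $A$ if $D=B\cup C$, $B\cap C=A$ as vertex sets, and the edge set of $D$ is the union of the edge sets of $B$ and $C$. $K$ has the free amalgamation property (FAP) if whenever $A,B,C\in K$ and $D=B\oplus_A C$, then $D\in K$. A countable graph $M$ is the Fra\"{i}ss\'{e} limit of $K$ if every finite induced subgraph of $M$ is in $K$, and for every finite induced subgraph $A\subseteq M$ and every $B\in K$ with $A\subseteq B$ there is an embedding $f\colon B\to M$ fixing $A$ pointwise. -}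

module Defs where

open import Data.Nat using (ℕ)
open import Data.Fin using (Fin)
open import Data.List using (List)
open import Data.List.Relation.Unary.All using (All)
open import Data.Product using (Σ; _×_; ∃; _,_)
open import Data.Sum using (_⊎_)
open import Relation.Nullary using (¬_)
open import Relation.Binary.PropositionalEquality using (_≡_; _≢_)

record Graph : Set₁ where
  field
    V      : Set
    R      : V → V → Set
    sym    : ∀ {u v} → R u v → R v u
    irrefl : ∀ {v} → ¬ R v v
open Graph public

record FinGraph : Set₁ where
  field
    size    : ℕ
    E       : Fin size → Fin size → Set
    E-sym   : ∀ {i j} → E i j → E j i
    E-irr   : ∀ {i} → ¬ E i i
open FinGraph public

⟦_⟧ : FinGraph → Graph
⟦ G ⟧ = record { V = Fin (size G) ; R = E G ; sym = E-sym G ; irrefl = E-irr G }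

Injective : {A B : Set} → (A → B) → Set
Injective f = ∀ {x y} → f x ≡ f y → x ≡ y

record Embedding (G H : Graph) : Set where
  field
    map       : V G → V H
    injective : Injective map
    preserve  : ∀ {u v} → R G u v → R H (map u) (map v)
    reflect   : ∀ {u v} → R H (map u) (map v) → R G u v
open Embedding public

record Iso (G H : Graph) : Set where
  field
    emb        : Embedding G H
    surjective : ∀ (w : V H) → ∃ λ v → map emb v ≡ w
open Iso public

FinIso : FinGraph → FinGraph → Set
FinIso G H = Iso ⟦ G ⟧ ⟦ H ⟧

_↪_ : FinGraph → FinGraph → Set
A ↪ B = Embedding ⟦ A ⟧ ⟦ B ⟧

Class : Set₁
Class = FinGraph → Set

IsoClosed : Class → Set₁
IsoClosed K = ∀ G H → FinIso G H → K G → K H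

Hereditary : Class → Set₁
Hereditary K = ∀ A B → A ↪ B → K B → K A

-- Infinitely many isomorphism types: no finite list of graphs covers K up to isomorphism.
InfiniteClass : Class → Set₁
InfiniteClass K = ∀ (L : List FinGraph) →
  Σ FinGraph λ G → K G × All (λ H → ¬ FinIso G H) L

HasEdgeGraph : Class → Set₁
HasEdgeGraph K = Σ FinGraph λ G → K G × Σ (Fin (size G)) λ i → Σ (Fin (size G)) λ j → E G i j

record IsFreeAmalgam (A B C D : FinGraph) (iB : A ↪ B) (iC : A ↪ C)
                     (f : B ↪ D) (g : C ↪ D) : Set where
  field
    commute  : ∀ a → map f (map iB a) ≡ map g (map iC a)
    cover    : ∀ d → (∃ λ b → map f b ≡ d) ⊎ (∃ λ c → map g c ≡ d)
    meet     : ∀ b c → map f b ≡ map g c → ∃ λ a → map iB a ≡ b × map iC a ≡ c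
    edges    : ∀ x y → E D x y →
                 (Σ _ λ b → Σ _ λ b' → map f b ≡ x × map f b' ≡ y)
               ⊎ (Σ _ λ c → Σ _ λ c' → map g c ≡ x × map g c' ≡ y)

FAP : Class → Set₁
FAP K = ∀ A B C D (iB : A ↪ B) (iC : A ↪ C) (f : B ↪ D) (g : C ↪ D) →
  K A → K B → K C → IsFreeAmalgam A B C D iB iC f g → K D

Countable : Graph → Set
Countable M = Σ (V M → ℕ) Injective

induced : (M : Graph) (n : ℕ) → (Fin n → V M) → FinGraph
induced M n h = record
  { size = n ; E = λ i j → R M (h i) (h j)
  ; E-sym = sym M ; E-irr = irrefl M }

record IsFraisseLimit (K : Class) (M : Graph) : Set₁ where
  field
    countable : Countable M
    age⊆K     : ∀ n (h : Fin n → V M) → Injective h → K (induced M n h)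
    extension : ∀ n (h : Fin n → V M) → Injective h →
                ∀ (B : FinGraph) → K B → (e : induced M n h ↪ B) →
                Σ (Embedding ⟦ B ⟧ M) λ φ → ∀ i → map φ (map e i) ≡ h i

Colouring : Graph → Set → Set
Colouring G C = Σ (V G → C) λ c → ∀ {u v} → R G u v → c u ≢ c v

ChromaticNumberω : Graph → Set
ChromaticNumberω G = (∀ (k : ℕ) → ¬ Colouring G (Fin k)) × Colouring G ℕ

{-# OPTIONS --safe #-}
-- The stars S(P) — a centre joined to exactly the leaves selected by P, the leaves
-- being independent — all lie in K: a single vertex and an edge come from the graph
-- with an edge, two non-adjacent vertices are a free amalgam over the empty graph, and
-- a star with one more leaf is the free amalgam of a smaller star and a one-leaf star
-- over the centre. By the extension property, over any finite independent set U ∪ B the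
-- limit M has a vertex x adjacent to all of B and to nothing in U.
--
-- Given a colouring c, one builds, for every j and every finite independent F, a
-- rainbow independent set Q of size j with Q ∪ F independent: take such Q for F, then
-- such Q' for Q ∪ F, and x adjacent to all of Q and to nothing in Q' ∪ F. If c x is
-- new on Q' then x extends Q'; otherwise c x = c q' for some q' ∈ Q', and as x is
-- adjacent to all of Q the colour c q' is new on Q, so q' extends Q. A rainbow set of
-- size k + 1 rules out k colours; an injection into ℕ is a colouring with ω colours.
module Submission where

open import Defs
open import Data.Bool using (Bool; true; false; T)
open import Data.Empty using (⊥; ⊥-elim)
open import Data.Fin as Fin using (Fin; zero; suc; punchIn; _↑ˡ_)
open import Data.Fin.Properties using (pigeonhole; <⇒≢; 0≢1+n; suc-injective; punchIn-injective; ↑ˡ-injective)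
open import Data.List as List using (List; []; _∷_; _++_; length; lookup)
open import Data.List.Properties using (map-++; map-∘; map-id)
open import Data.List.Membership.Propositional using (find)
open import Data.List.Membership.Propositional.Properties using (∈-lookup)
open import Data.List.Relation.Unary.All as All using (All; []; _∷_)
import Data.List.Relation.Unary.All.Properties as Allₚ
open import Data.List.Relation.Unary.Any using (any?; index)
open import Data.List.Relation.Unary.Any.Properties using (lookup-index)
open import Data.List.Relation.Unary.AllPairs using (AllPairs; []; _∷_)
import Data.List.Relation.Unary.AllPairs.Properties as AllPairsₚ
open import Data.List.Relation.Binary.Permutation.Propositional using (_↭_; ↭-trans; ↭-sym; ↭⇒↭ₛ)
import Data.List.Relation.Binary.Permutation.Propositional.Properties as ↭
import Data.List.Relation.Binary.Permutation.Setoid.Properties as ↭ₛ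
open import Data.Nat using (ℕ; zero; suc; _≤_)
open import Data.Nat.Properties using (≮⇒≥; 1+n≰n)
open import Data.Product using (∃; _×_; _,_; proj₁; proj₂)
open import Data.Sum using (_⊎_; inj₁; inj₂)
open import Data.Unit using (tt)
open import Function using (_∘_; _on_)
open import Relation.Binary.Definitions using (Symmetric; DecidableEquality; _Respects_)
open import Relation.Binary.PropositionalEquality as ≡ using (_≡_; _≢_; refl; cong; cong₂; subst)
open import Relation.Nullary using (¬_; yes; no)
open import Relation.Nullary.Decidable using (decidable-stable)

module _ {A : Set} {R : A → A → Set} where

  AllPairs-++⁻ : ∀ xs {ys} → AllPairs R (xs ++ ys) →
                 AllPairs R xs × AllPairs R ys × All (λ x → All (R x) ys) xs
  AllPairs-++⁻ []       pys          = [] , pys , []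
  AllPairs-++⁻ (x ∷ xs) (pxys ∷ pxsys) =
    let pxs , pys , cross = AllPairs-++⁻ xs pxsys
        px , pxys′        = Allₚ.++⁻ xs pxys
    in px ∷ pxs , pys , pxys′ ∷ cross

  AllPairs-lookup : Symmetric R → ∀ {xs} → AllPairs R xs →
                    ∀ {i j} → i ≢ j → R (lookup xs i) (lookup xs j)
  AllPairs-lookup _   (_  ∷ _)   {zero}  {zero}  0≢0 = ⊥-elim (0≢0 refl)
  AllPairs-lookup _   (px ∷ _)   {zero}  {suc j} _   = All.lookup px (∈-lookup j)
  AllPairs-lookup sym (px ∷ _)   {suc i} {zero}  _   = sym (All.lookup px (∈-lookup i))
  AllPairs-lookup sym (_  ∷ pxs) {suc i} {suc j} i≢j = AllPairs-lookup sym pxs (i≢j ∘ cong suc)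

Rainbow : {A C : Set} → (A → C) → List A → Set
Rainbow c = AllPairs (λ u v → c u ≢ c v)

rainbow-length : {A : Set} {k : ℕ} (c : A → Fin k) {xs : List A} → Rainbow c xs → length xs ≤ k
rainbow-length c {xs} rainbow = ≮⇒≥ λ k<length →
  let i , j , i<j , same-colour = pigeonhole k<length (c ∘ lookup xs)
  in AllPairs-lookup (λ ne → ne ∘ ≡.sym) rainbow (<⇒≢ i<j) same-colour

module _ (G : Graph) where

  Apart : V G → V G → Set
  Apart u v = u ≢ v × ¬ R G u v

  apart-sym : Symmetric Apart
  apart-sym (u≢v , ¬uv) = u≢v ∘ ≡.sym , ¬uv ∘ Graph.sym G

  Independent : List (V G) → Set
  Independent = AllPairs Apart

  independent-resp-↭ : Independent Respects _↭_
  independent-resp-↭ p = ↭ₛ.AllPairs-resp-↭ (≡.setoid (V G)) apart-sym (≡.resp₂ Apart) (↭⇒↭ₛ p)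

  Realises : V G → V G × Bool → Set
  Realises x (v , false) = Apart x v
  Realises x (v , true)  = R G x v

  realises : ∀ {x v} b → x ≢ v → (R G x v → T b) → (T b → R G x v) → Realises x (v , b)
  realises false x≢v xv⇒b _  = x≢v , xv⇒b
  realises true  _   _    b⇒xv = b⇒xv tt

  ExtendsIndependentSets : Set
  ExtendsIndependentSets =
    ∀ U B → Independent (U ++ B) → ∃ λ x → All (Apart x) U × All (R G x) B

StarEdge : ∀ {N} → (Fin N → Bool) → Fin (suc N) → Fin (suc N) → Set
StarEdge P zero    (suc i) = T (P i)
StarEdge P (suc i) zero    = T (P i)
StarEdge P _       _       = ⊥

StarEdge-sym : ∀ {N} (P : Fin N → Bool) {i j} → StarEdge P i j → StarEdge P j i
StarEdge-sym P {zero}  {suc _} e = e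
StarEdge-sym P {suc _} {zero}  e = e

StarEdge-irr : ∀ {N} (P : Fin N → Bool) {i} → ¬ StarEdge P i i
StarEdge-irr P {zero}  ()
StarEdge-irr P {suc _} ()

Star : (N : ℕ) → (Fin N → Bool) → FinGraph
Star N P = record
  { size  = suc N
  ; E     = StarEdge P
  ; E-sym = λ {i} {j} → StarEdge-sym P {i} {j}
  ; E-irr = λ {i} → StarEdge-irr P {i}
  }

Point : FinGraph
Point = Star 0 λ ()

Empty : FinGraph
Empty = record { size = 0 ; E = λ () ; E-sym = λ { {()} } ; E-irr = λ { {()} } }

empty↪ : ∀ H → Empty ↪ H
empty↪ H = record
  { map = λ () ; injective = λ { {()} } ; preserve = λ { {()} } ; reflect = λ { {()} } }

point↪ : ∀ {P} H → Fin (size H) → Star 0 P ↪ H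
point↪ H v = record
  { map       = λ _ → v
  ; injective = λ { {zero} {zero} _ → refl }
  ; preserve  = λ { {zero} {zero} () }
  ; reflect   = ⊥-elim ∘ E-irr H
  }

edge↪ : ∀ H {u v} → E H u v → Star 1 (λ _ → true) ↪ H
edge↪ H {u} {v} uv = record
  { map = ends ; injective = λ {i} {j} → ends-injective {i} {j}
  ; preserve = λ {i} {j} → ends-preserve {i} {j} ; reflect = λ {i} {j} → ends-reflect {i} {j} }
  where
  ends : Fin 2 → Fin (size H)
  ends zero       = u
  ends (suc zero) = v

  u≢v : u ≢ v
  u≢v refl = E-irr H uv

  ends-injective : Injective ends
  ends-injective {zero}     {zero}     _   = refl
  ends-injective {zero}     {suc zero} u≡v = ⊥-elim (u≢v u≡v)
  ends-injective {suc zero} {zero}     v≡u = ⊥-elim (u≢v (≡.sym v≡u))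
  ends-injective {suc zero} {suc zero} _   = refl

  ends-preserve : ∀ {i j} → StarEdge (λ _ → true) i j → E H (ends i) (ends j)
  ends-preserve {zero}     {suc zero} _ = uv
  ends-preserve {suc zero} {zero}     _ = E-sym H uv

  ends-reflect : ∀ {i j} → E H (ends i) (ends j) → StarEdge (λ _ → true) i j
  ends-reflect {zero}     {zero}     uu = E-irr H uu
  ends-reflect {zero}     {suc zero} _  = tt
  ends-reflect {suc zero} {zero}     _  = tt
  ends-reflect {suc zero} {suc zero} vv = E-irr H vv

leaves↪ : ∀ {G : Graph} {N} {h : Fin N → V G} (P : Fin N → Bool) →
          (∀ i j → ¬ R G (h i) (h j)) → induced G N h ↪ Star N P
leaves↪ P independent = record
  { map = suc ; injective = suc-injective
  ; preserve = λ {i} {j} hihj → ⊥-elim (independent i j hihj) ; reflect = λ () }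

module _ {N : ℕ} (P : Fin (suc N) → Bool) where

  tail↪ : Star N (P ∘ suc) ↪ Star (suc N) P
  tail↪ = record
    { map = punchIn (suc zero) ; injective = punchIn-injective (suc zero) _ _
    ; preserve = λ {i} {j} → preserves {i} {j} ; reflect = λ {i} {j} → reflects {i} {j} }
    where
    preserves : ∀ {i j} → StarEdge (P ∘ suc) i j →
               StarEdge P (punchIn (suc zero) i) (punchIn (suc zero) j)
    preserves {zero}  {suc _} e = e
    preserves {suc _} {zero}  e = e

    reflects : ∀ {i j} → StarEdge P (punchIn (suc zero) i) (punchIn (suc zero) j) →
              StarEdge (P ∘ suc) i j
    reflects {zero}  {suc _} e = e
    reflects {suc _} {zero}  e = e

  head↪ : Star 1 (λ _ → P zero) ↪ Star (suc N) P
  head↪ = record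
    { map = _↑ˡ N ; injective = ↑ˡ-injective N _ _
    ; preserve = λ {i} {j} → preserves {i} {j} ; reflect = λ {i} {j} → reflects {i} {j} }
    where
    preserves : ∀ {i j} → StarEdge (λ _ → P zero) i j → StarEdge P (i ↑ˡ N) (j ↑ˡ N)
    preserves {zero}     {suc zero} e = e
    preserves {suc zero} {zero}     e = e

    reflects : ∀ {i j} → StarEdge P (i ↑ˡ N) (j ↑ˡ N) → StarEdge (λ _ → P zero) i j
    reflects {zero}     {suc zero} e = e
    reflects {suc zero} {zero}     e = e

  star-free-amalgam : IsFreeAmalgam Point (Star N (P ∘ suc)) (Star 1 (λ _ → P zero)) (Star (suc N) P)
                                    (point↪ _ zero) (point↪ _ zero) tail↪ head↪
  star-free-amalgam = record
    { commute = λ { zero → refl }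
    ; cover   = λ { zero → inj₁ (zero , refl)
                  ; (suc zero) → inj₂ (suc zero , refl)
                  ; (suc (suc i)) → inj₁ (suc i , refl) }
    ; meet    = λ { zero zero _ → zero , refl , refl
                  ; zero (suc zero) () ; (suc _) zero () ; (suc _) (suc zero) () }
    ; edges   = λ { zero (suc zero) _ → inj₂ (zero , suc zero , refl , refl)
                  ; (suc zero) zero _ → inj₂ (suc zero , zero , refl , refl)
                  ; zero (suc (suc i)) _ → inj₁ (zero , suc i , refl , refl)
                  ; (suc (suc i)) zero _ → inj₁ (suc i , zero , refl , refl)
                  ; zero zero () ; (suc _) (suc _) () }
    }

two-points-free-amalgam : IsFreeAmalgam Empty Point Point (Star 1 (λ _ → false))
                                        (empty↪ _) (empty↪ _) (point↪ _ zero) (point↪ _ (suc zero))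
two-points-free-amalgam = record
  { commute = λ ()
  ; cover   = λ { zero → inj₁ (zero , refl) ; (suc zero) → inj₂ (zero , refl) }
  ; meet    = λ { zero zero () }
  ; edges   = λ { zero zero () ; zero (suc zero) () ; (suc zero) zero ()
                ; (suc zero) (suc zero) () }
  }

module _ {K : Class} (hereditary : Hereditary K) (edge : HasEdgeGraph K) where

  point∈K : ∀ {P} → K (Star 0 P)
  point∈K = let G , G∈K , u , _ = edge in hereditary _ G (point↪ G u) G∈K

  empty∈K : K Empty
  empty∈K = let G , G∈K , _ = edge in hereditary _ G (empty↪ G) G∈K

  star₁∈K : FAP K → ∀ b → K (Star 1 (λ _ → b))
  star₁∈K _   true  = let G , G∈K , _ , _ , uv = edge in hereditary _ G (edge↪ G uv) G∈K
  star₁∈K fap false = fap _ _ _ _ _ _ _ _ empty∈K point∈K point∈K two-points-free-amalgam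

  star∈K : FAP K → ∀ N P → K (Star N P)
  star∈K fap zero    P = point∈K
  star∈K fap (suc N) P =
    fap _ _ _ _ _ _ _ _ point∈K (star∈K fap N (P ∘ suc)) (star₁∈K fap (P zero)) (star-free-amalgam P)

module _ {K : Class} {M : Graph} (star∈K : ∀ N P → K (Star N P)) (limit : IsFraisseLimit K M) where
  open IsFraisseLimit limit using (extension)

  realise-star : ∀ N (h : Fin N → V M) → Injective h → (∀ i j → ¬ R M (h i) (h j)) →
                 (P : Fin N → Bool) → ∃ λ x → ∀ i → Realises M x (h i , P i)
  realise-star N h injective-h independent-h P
    with extension N h injective-h (Star N P) (star∈K N P) (leaves↪ {M} P independent-h)
  ... | φ , φ-leaf = map φ zero , λ i →
    realises M (P i) (centre≢leaf i) (adjacent⇒selected i) (selected⇒adjacent i)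
    where
    centre≢leaf : ∀ i → map φ zero ≢ h i
    centre≢leaf i x≡hi = 0≢1+n (injective φ (≡.trans x≡hi (≡.sym (φ-leaf i))))

    adjacent⇒selected : ∀ i → R M (map φ zero) (h i) → T (P i)
    adjacent⇒selected i = reflect φ {zero} {suc i} ∘ subst (R M _) (≡.sym (φ-leaf i))

    selected⇒adjacent : ∀ i → T (P i) → R M (map φ zero) (h i)
    selected⇒adjacent i = subst (R M _) (φ-leaf i) ∘ preserve φ {zero} {suc i}

  realise-pattern : (L : List (V M × Bool)) → AllPairs (Apart M on proj₁) L →
                    ∃ λ x → All (Realises M x) L
  realise-pattern L apart =
    let x , realised = realise-star (length L) (proj₁ ∘ lookup L)
                                    injective-lookup independent-lookup (proj₂ ∘ lookup L)
    in x , All.tabulate λ v∈L →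
             subst (Realises M x) (≡.sym (lookup-index v∈L)) (realised (index v∈L))
    where
    apart-lookup : ∀ {i j} → i ≢ j → Apart M (proj₁ (lookup L i)) (proj₁ (lookup L j))
    apart-lookup = AllPairs-lookup (apart-sym M) apart

    injective-lookup : Injective (proj₁ ∘ lookup L)
    injective-lookup {i} {j} same = decidable-stable (i Fin.≟ j) λ i≢j → proj₁ (apart-lookup i≢j) same

    independent-lookup : ∀ i j → ¬ R M (proj₁ (lookup L i)) (proj₁ (lookup L j))
    independent-lookup i j with i Fin.≟ j
    ... | yes refl = irrefl M
    ... | no  i≢j  = proj₂ (apart-lookup i≢j)

  extends-independent-sets : ExtendsIndependentSets M
  extends-independent-sets U B independent =
    let x , realised = realise-pattern L
                         (AllPairsₚ.map⁻ (subst (Independent M) (≡.sym untag) independent))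
        realised-U , realised-B = Allₚ.++⁻ (tag false U) realised
    in x , Allₚ.map⁻ realised-U , Allₚ.map⁻ realised-B
    where
    tag : Bool → List (V M) → List (V M × Bool)
    tag b = List.map (_, b)

    L : List (V M × Bool)
    L = tag false U ++ tag true B

    untag-one : ∀ b xs → List.map proj₁ (tag b xs) ≡ xs
    untag-one b xs = ≡.trans (≡.sym (map-∘ xs)) (map-id xs)

    untag : List.map proj₁ L ≡ U ++ B
    untag = ≡.trans (map-++ proj₁ (tag false U) (tag true B))
                    (cong₂ _++_ (untag-one false U) (untag-one true B))

injective-colouring : {G : Graph} {C : Set} (c : V G → C) → Injective c → Colouring G C
injective-colouring {G} c injective-c = c , λ uv cu≡cv →
  irrefl G (subst (R G _) (≡.sym (injective-c cu≡cv)) uv)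

module _ {G : Graph} (extend : ExtendsIndependentSets G) {C : Set} (_≟_ : DecidableEquality C)
         (c : V G → C) (proper : ∀ {u v} → R G u v → c u ≢ c v) where

  RainbowOver : List (V G) → List (V G) → Set
  RainbowOver F Q = Independent G (Q ++ F) × Rainbow c Q

  rainbow-step : ∀ F Q Q′ → RainbowOver F Q → RainbowOver (Q ++ F) Q′ →
                 ∃ λ y → RainbowOver F (y ∷ Q) ⊎ RainbowOver F (y ∷ Q′)
  rainbow-step F Q Q′ (QF , rainbow-Q) (Q′QF , rainbow-Q′) = choose (extend (Q′ ++ F) Q Q′FQ)
    where
    Q′FQ : Independent G ((Q′ ++ F) ++ Q)
    Q′FQ = independent-resp-↭ G
      (↭-trans (↭.++⁺ˡ Q′ (↭.++-comm Q F)) (↭-sym (↭.++-assoc Q′ F Q))) Q′QF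

    choose : (∃ λ x → All (Apart G x) (Q′ ++ F) × All (R G x) Q) →
             ∃ λ y → RainbowOver F (y ∷ Q) ⊎ RainbowOver F (y ∷ Q′)
    choose (x , x-apart , x-adjacent) with any? (λ q′ → c x ≟ c q′) Q′
    ... | no new-colour =
      x , inj₂ ( x-apart ∷ proj₁ (AllPairs-++⁻ (Q′ ++ F) Q′FQ)
               , Allₚ.¬Any⇒All¬ Q′ new-colour ∷ rainbow-Q′)
    ... | yes repeated =
      let q′ , q′∈Q′ , cx≡cq′ = find repeated
      in q′ , inj₁ ( All.lookup (proj₂ (proj₂ (AllPairs-++⁻ Q′ Q′QF))) q′∈Q′ ∷ QF
                   , All.map (λ xq cq′≡cq → proper xq (≡.trans cx≡cq′ cq′≡cq)) x-adjacent ∷ rainbow-Q)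

  rainbow-independent-set : ∀ j F → Independent G F → ∃ λ Q → length Q ≡ j × RainbowOver F Q
  rainbow-independent-set zero    F F-independent = [] , refl , F-independent , []
  rainbow-independent-set (suc j) F F-independent
    with rainbow-independent-set j F F-independent
  ... | Q , |Q|≡j , Q-over
    with rainbow-independent-set j (Q ++ F) (proj₁ Q-over)
  ... | Q′ , |Q′|≡j , Q′-over
    with rainbow-step F Q Q′ Q-over Q′-over
  ... | y , inj₁ yQ-over  = y ∷ Q  , cong suc |Q|≡j  , yQ-over
  ... | y , inj₂ yQ′-over = y ∷ Q′ , cong suc |Q′|≡j , yQ′-over

no-finite-colouring : {G : Graph} → ExtendsIndependentSets G → ∀ k → ¬ Colouring G (Fin k)
no-finite-colouring {G} extend k (c , proper) =
  let Q , |Q|≡1+k , _ , rainbow = rainbow-independent-set {G} extend Fin._≟_ c proper (suc k) [] []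
  in 1+n≰n (subst (_≤ k) |Q|≡1+k (rainbow-length c rainbow))

mainTheorem1 : (K : Class) → InfiniteClass K → IsoClosed K → Hereditary K → HasEdgeGraph K → FAP K
    → (M : Graph) → IsFraisseLimit K M → ChromaticNumberω M
mainTheorem1 K _ _ hereditary edge fap M limit =
    no-finite-colouring {M} (extends-independent-sets (star∈K hereditary edge fap) limit)
  , injective-colouring {M} (proj₁ countable) (proj₂ countable)
  where open IsFraisseLimit limit using (countable)
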